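{- Let $S$ be a numerical semigroup with at least two gaps, and let $g_1<g_2<\cdots<g_t$ ($t\ge2$) be its gaps, i.e. the elements of $\mathbb{N}_0\setminus S$. Then the partition $(g_1,\ldots,g_t)$ into distinct parts is unrefinable. In other words, identifying a numerical semigroup with the partition formed by its gaps, the set of numerical semigroups is contained in the set $\mathcal{U}$ of unrefinable partitions.
   Context: A numerical semigroup is a subset $S\subseteq\mathbb{N}_0$ with $0\in S$, closed under addition, and with $\mathbb{N}_0\setminus S$ finite; the elements of $\mathbb{N}_0\setminus S$ are its gaps. A partition into distinct parts is a sequence $\lambda=(\lambda_1,\ldots,\lambda_t)$ of positive integers with $\lambda_1<\cdots<\lambda_t$ and $t\ge 2$; its missing parts are the elements of $\{1,\ldots,\lambda_t\}\setminus\{\lambda_1,\ldots,\lambda_t\}$. $\lambda$ is refinable if some part equals a sum of at least two pairwise distinct missing parts, and unrefinable otherwise. -}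

module Defs where

open import Data.Nat using (ℕ; zero; suc; _+_; _≤_; _<_; _⊔_)
open import Data.List using (List; []; _∷_; length; foldr)
open import Data.Nat.ListAction using (sum)
open import Data.List.Membership.Propositional using (_∈_; _∉_)
open import Data.List.Relation.Unary.All using (All)
open import Data.List.Relation.Unary.Linked using (Linked)
open import Data.List.Relation.Unary.Unique.Propositional using (Unique)
open import Data.Product using (Σ; _×_; ∃; ∃-syntax)
open import Relation.Nullary using (¬_)
open import Relation.Binary.PropositionalEquality using (_≡_)

record NumericalSemigroup (S : ℕ → Set) : Set where
  field
    zero∈    : S 0
    closed+  : ∀ {a b} → S a → S b → S (a + b)
    cofinite : ∃[ N ] (∀ n → N ≤ n → S n)

Gap : (ℕ → Set) → ℕ → Set
Gap S g = ¬ S g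

-- largest part λ_t of a partition (maximum of the list; for a strictly
-- increasing list this is its last element)
largestPart : List ℕ → ℕ
largestPart = foldr _⊔_ 0

DistinctPartition : List ℕ → Set
DistinctPartition λs = All (λ x → 1 ≤ x) λs × Linked _<_ λs × 2 ≤ length λs

MissingPart : List ℕ → ℕ → Set
MissingPart λs m = 1 ≤ m × m ≤ largestPart λs × m ∉ λs

Refinable : List ℕ → Set
Refinable λs =
  Σ ℕ λ p → p ∈ λs ×
    (Σ (List ℕ) λ ms → All (MissingPart λs) ms × Unique ms × 2 ≤ length ms × sum ms ≡ p)

Unrefinable : List ℕ → Set
Unrefinable λs = ¬ Refinable λs

-- Constructively, a missing part of the gap partition is only known not to be
-- a gap, i.e. to lie in ¬ ¬ S; but ¬ ¬ S is again closed under 0 and +, so a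
-- sum of missing parts lies in ¬ ¬ S and hence cannot be a part (a gap).
module Submission where

open import Defs
open import Data.Nat using (ℕ; _+_; _≤_; _<_; zero; suc; z≤n; s≤s)
open import Data.List using (List; length; []; _∷_)
open import Data.List.Membership.Propositional using (_∈_)
open import Data.List.Relation.Unary.Linked using (Linked)
open import Data.List.Relation.Unary.All as All using (All; []; _∷_)
open import Data.Nat.ListAction using (sum)
open import Data.Product using (_×_; _,_)
open import Data.Empty using (⊥-elim)
open import Relation.Nullary using (¬_)
open import Relation.Binary.PropositionalEquality using (subst; sym)
open import Function.Bundles using (_⇔_; module Equivalence)

sum-closed : {P : ℕ → Set} → P 0 → (∀ {a b} → P a → P b → P (a + b)) →
             ∀ {ms} → All P ms → P (sum ms)
sum-closed P0 P+ []         = P0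
sum-closed P0 P+ (pm ∷ pms) = P+ pm (sum-closed P0 P+ pms)

module _ {S : ℕ → Set} (ns : NumericalSemigroup S) where
  open NumericalSemigroup ns

  ¬¬-closed+ : ∀ {a b} → ¬ ¬ S a → ¬ ¬ S b → ¬ ¬ S (a + b)
  ¬¬-closed+ ¬¬Sa ¬¬Sb ¬Sab = ¬¬Sa λ Sa → ¬¬Sb λ Sb → ¬Sab (closed+ Sa Sb)

  ¬¬-sum-closed : ∀ {ms} → All (λ m → ¬ ¬ S m) ms → ¬ ¬ S (sum ms)
  ¬¬-sum-closed = sum-closed (λ ¬S0 → ¬S0 zero∈) ¬¬-closed+

  module _ {gs : List ℕ} (gaps : ∀ n → (n ∈ gs) ⇔ Gap S n) where

    gap-positive : ∀ {g} → g ∈ gs → 1 ≤ g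
    gap-positive {zero}  0∈gs = ⊥-elim (Equivalence.to (gaps 0) 0∈gs zero∈)
    gap-positive {suc g} _    = s≤s z≤n

    missingPart⇒¬¬∈ : ∀ {m} → MissingPart gs m → ¬ ¬ S m
    missingPart⇒¬¬∈ (_ , _ , m∉gs) ¬Sm = m∉gs (Equivalence.from (gaps _) ¬Sm)

    gaps-unrefinable : Unrefinable gs
    gaps-unrefinable (p , p∈gs , ms , missing , _ , _ , sum≡p) =
      ¬¬-sum-closed (All.map missingPart⇒¬¬∈ missing)
        (subst (Gap S) (sym sum≡p) (Equivalence.to (gaps p) p∈gs))

mainTheorem2 : (S : ℕ → Set) → NumericalSemigroup S →
    (gs : List ℕ) → Linked _<_ gs → (∀ n → (n ∈ gs) ⇔ Gap S n) →
    2 ≤ length gs →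
    DistinctPartition gs × Unrefinable gs
mainTheorem2 S ns gs increasing gaps twoGaps =
  (All.tabulate (gap-positive ns gaps) , increasing , twoGaps) ,
  gaps-unrefinable ns gaps
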